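{- For any graph $G$ and any integer $\ell\geq 0$, $\operatorname{Z}_{(\ell)}(G)=\operatorname{Z}'_{(\ell)}(G)$. In particular, a set $B\subseteq V(G)$ is an $\ell$-leaky forcing set of $G$ if and only if $B$ is an $\ell$-edge-leaky forcing set of $G$.
   Context: All graphs are finite simple graphs. Given a graph $G$ and a set $B\subseteq V(G)$ of initially blue vertices (all other vertices white), the zero forcing color-change rule says: if a blue vertex $u$ has exactly one white neighbor $w$, then $u$ may force $w$, i.e. color $w$ blue. A vertex leak is a vertex that is not allowed to perform any force. A set $B$ is an $\ell$-leaky forcing set of $G$ if for every set of $\ell$ vertex leaks, exhaustively applying the color-change rule from $B$ (with leaks never forcing) turns all of $G$ blue; $\operatorname{Z}_{(\ell)}(G)$ is the minimum size of an $\ell$-leaky forcing set. An edge leak is an edge $xy$ across which no force may be performed (neither $x\rightarrow y$ nor $y\rightarrow x$ allowed). A set $B$ is an $\ell$-edge-leaky forcing set if for every set of $\ell$ edge leaks, exhaustively applying the color-change rule from $B$ (never forcing across an edge leak) turns all of $G$ blue; $\operatorname{Z}'_{(\ell)}(G)$ is the minimum size of an $\ell$-edge-leaky forcing set. -}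

module Defs where

open import Data.Nat using (ℕ; _≤_)
open import Data.Bool using (Bool; true; false)
open import Data.Fin using (Fin)
open import Data.Fin.Subset using (Subset; _∈_; _∉_; ∣_∣)
open import Data.List using (List; length)
open import Data.List.Relation.Unary.All using (All)
import Data.List.Membership.Propositional as LM
open import Data.Product using (Σ; _×_; _,_; proj₁; proj₂)
open import Data.Sum using (_⊎_)
open import Relation.Binary.PropositionalEquality using (_≡_; _≢_)
open import Relation.Nullary using (¬_)

record Graph (n : ℕ) : Set where
  field
    adj    : Fin n → Fin n → Bool
    sym    : ∀ u v → adj u v ≡ adj v u
    irrefl : ∀ u → adj u u ≡ false

open Graph public

Adjacent : ∀ {n} → Graph n → Fin n → Fin n → Set
Adjacent G u v = adj G u v ≡ true

-- Vertices that end up blue when exhaustively applying the color-change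
-- rule from the initial blue set B, where vertices in L (vertex leaks)
-- never force.  (Least fixed point of the rule = final coloring.)
data VBlue {n} (G : Graph n) (B : Subset n) (L : Subset n) : Fin n → Set where
  init  : ∀ {v} → v ∈ B → VBlue G B L v
  force : ∀ {u v} → VBlue G B L u → u ∉ L → Adjacent G u v →
          (∀ w → Adjacent G u w → w ≢ v → VBlue G B L w) →
          VBlue G B L v

data EBlue {n} (G : Graph n) (B : Subset n) (E : List (Fin n × Fin n)) : Fin n → Set where
  init  : ∀ {v} → v ∈ B → EBlue G B E v
  force : ∀ {u v} → EBlue G B E u →
          ¬ ((u , v) LM.∈ E ⊎ (v , u) LM.∈ E) → Adjacent G u v →
          (∀ w → Adjacent G u w → w ≢ v → EBlue G B E w) →
          EBlue G B E v

LeakyForcing : ∀ {n} → Graph n → ℕ → Subset n → Set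
LeakyForcing {n} G ℓ B = ∀ (L : Subset n) → ∣ L ∣ ≤ ℓ → ∀ v → VBlue G B L v

-- B is an ℓ-edge-leaky forcing set: for every set of (at most) ℓ edges
-- (given as a list of ordered pairs which are edges; repetitions allowed,
-- which only shrinks the underlying set), all vertices become blue.
EdgeLeakyForcing : ∀ {n} → Graph n → ℕ → Subset n → Set
EdgeLeakyForcing {n} G ℓ B =
  ∀ (E : List (Fin n × Fin n)) → All (λ e → Adjacent G (proj₁ e) (proj₂ e)) E →
  length E ≤ ℓ → ∀ v → EBlue G B E v

IsLeakyForcingNumber : ∀ {n} → Graph n → ℕ → ℕ → Set
IsLeakyForcingNumber {n} G ℓ k =
  (Σ (Subset n) λ B → ∣ B ∣ ≡ k × LeakyForcing G ℓ B) ×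
  (∀ B → LeakyForcing G ℓ B → k ≤ ∣ B ∣)

IsEdgeLeakyForcingNumber : ∀ {n} → Graph n → ℕ → ℕ → Set
IsEdgeLeakyForcingNumber {n} G ℓ k =
  (Σ (Subset n) λ B → ∣ B ∣ ≡ k × EdgeLeakyForcing G ℓ B) ×
  (∀ B → EdgeLeakyForcing G ℓ B → k ≤ ∣ B ∣)

-- Both kinds of leak are instances of one forcing process in which some forces
-- u → v are forbidden, and its final coloring C is the least set containing B
-- that admits no allowed force.  A leak set of one kind can be traded for one
-- of the other kind, of no larger size, that forbids every force out of C which
-- the original leaks forbid, so that C stays closed and every vertex still
-- ends up in C.  A leaked vertex u blocks at most one force out of C, namely
-- towards its unique neighbour outside C, so one edge leak per vertex leak
-- suffices.  Conversely a leaked edge xy blocks x → y only if y ends outside C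
-- and y → x only if x ends inside C, so leaking y when y ∈ C and x otherwise
-- blocks whichever of these forces is relevant.
module Submission where

open import Defs
open import Data.Nat using (ℕ; suc; _≤_; _+_; z≤n; s≤s)
open import Data.Nat.Properties using (≤-trans; ≤-reflexive; n≤1+n; m≤n⇒m≤1+n; +-suc; +-monoʳ-≤; module ≤-Reasoning)
open import Data.Bool using (true)
open import Data.Bool.Properties using () renaming (_≟_ to _≟ᵇ_)
open import Data.Fin using (Fin; zero; suc)
open import Data.Fin.Properties using (_≟_; any?; all?)
open import Data.Fin.Subset using (Subset; _∈_; _∉_; ∣_∣; _⊆_; _⊃_; _∪_; ⁅_⁆; inside; outside) renaming (⊥ to ∅)
open import Data.Fin.Subset.Properties using (_∈?_; x∈⁅x⁆; x∈⁅y⁆⇒x≡y; x∈p∪q⁻; x∈p∪q⁺; q⊆p∪q; ∣⁅x⁆∣≡1; ∣⊥∣≡0)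
open import Data.Fin.Subset.Induction using (⊃-wellFounded)
open import Induction.WellFounded using (Acc; acc)
open import Data.Vec using ([]; _∷_; here; there)
open import Data.List using (List; []; _∷_; length; map)
open import Data.List.Properties using (length-map)
open import Data.List.Relation.Unary.All using (All; []; _∷_)
open import Data.List.Relation.Unary.Any using (here; there)
import Data.List.Membership.Propositional as List
open import Data.List.Membership.Propositional.Properties using (∈-map⁺)
open import Data.List.Membership.DecPropositional using () renaming (_∈?_ to ∈?-with)
open import Data.Product using (Σ; ∃; _×_; _,_; proj₁; proj₂)
open import Data.Product.Properties using (≡-dec)
open import Data.Sum using (_⊎_; inj₁; inj₂)
open import Data.Empty using (⊥-elim)
open import Relation.Binary.Definitions using (Decidable)
open import Relation.Binary.PropositionalEquality using (_≡_; _≢_; refl; cong; trans) renaming (sym to ≡-sym)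
open import Relation.Nullary using (¬_; Dec; yes; no)
open import Relation.Nullary.Decidable using (_×-dec_; _⊎-dec_; ¬?; _→-dec_)
open import Function.Bundles using (_⇔_; mk⇔; Equivalence)
open import Function.Properties.Equivalence using () renaming (sym to ⇔-sym)

∣p∪q∣≤∣p∣+∣q∣ : ∀ {n} (p q : Subset n) → ∣ p ∪ q ∣ ≤ ∣ p ∣ + ∣ q ∣
∣p∪q∣≤∣p∣+∣q∣ []            []            = z≤n
∣p∪q∣≤∣p∣+∣q∣ (outside ∷ p) (outside ∷ q) = ∣p∪q∣≤∣p∣+∣q∣ p q
∣p∪q∣≤∣p∣+∣q∣ (inside  ∷ p) (outside ∷ q) = s≤s (∣p∪q∣≤∣p∣+∣q∣ p q)
∣p∪q∣≤∣p∣+∣q∣ (inside  ∷ p) (inside  ∷ q) = s≤s (≤-trans (∣p∪q∣≤∣p∣+∣q∣ p q) (+-monoʳ-≤ ∣ p ∣ (n≤1+n ∣ q ∣)))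
∣p∪q∣≤∣p∣+∣q∣ (outside ∷ p) (inside  ∷ q) =
  ≤-trans (s≤s (∣p∪q∣≤∣p∣+∣q∣ p q)) (≤-reflexive (≡-sym (+-suc ∣ p ∣ ∣ q ∣)))

elements : ∀ {n} → Subset n → List (Fin n)
elements []            = []
elements (inside  ∷ p) = zero ∷ map suc (elements p)
elements (outside ∷ p) = map suc (elements p)

length-elements : ∀ {n} (p : Subset n) → length (elements p) ≡ ∣ p ∣
length-elements []            = refl
length-elements (inside  ∷ p) = cong suc (trans (length-map suc (elements p)) (length-elements p))
length-elements (outside ∷ p) = trans (length-map suc (elements p)) (length-elements p)

∈-elements : ∀ {n} {x : Fin n} {p : Subset n} → x ∈ p → x List.∈ elements p
∈-elements                        here      = here refl
∈-elements {p = inside  ∷ _} (there x∈p) = there (∈-map⁺ suc (∈-elements x∈p))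
∈-elements {p = outside ∷ _} (there x∈p) = ∈-map⁺ suc (∈-elements x∈p)

fromList : ∀ {n} → List (Fin n) → Subset n
fromList []       = ∅
fromList (x ∷ xs) = ⁅ x ⁆ ∪ fromList xs

∣fromList∣≤length : ∀ {n} (xs : List (Fin n)) → ∣ fromList xs ∣ ≤ length xs
∣fromList∣≤length {n} []       = ≤-reflexive (∣⊥∣≡0 n)
∣fromList∣≤length (x ∷ xs) = begin
  ∣ ⁅ x ⁆ ∪ fromList xs ∣       ≤⟨ ∣p∪q∣≤∣p∣+∣q∣ ⁅ x ⁆ (fromList xs) ⟩
  ∣ ⁅ x ⁆ ∣ + ∣ fromList xs ∣   ≡⟨ cong (_+ ∣ fromList xs ∣) (∣⁅x⁆∣≡1 x) ⟩
  suc ∣ fromList xs ∣           ≤⟨ s≤s (∣fromList∣≤length xs) ⟩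
  suc (length xs)               ∎
  where open ≤-Reasoning

∈-fromList : ∀ {n} {x : Fin n} {xs} → x List.∈ xs → x ∈ fromList xs
∈-fromList {x = x} (here refl) = x∈p∪q⁺ (inj₁ (x∈⁅x⁆ x))
∈-fromList         (there x∈xs) = x∈p∪q⁺ (inj₂ (∈-fromList x∈xs))

module _ {n} (G : Graph n) where

  Adjacent? : Decidable (Adjacent G)
  Adjacent? u v = adj G u v ≟ᵇ true

  data Forced (B : Subset n) (Ok : Fin n → Fin n → Set) : Fin n → Set where
    init  : ∀ {v} → v ∈ B → Forced B Ok v
    force : ∀ {u v} → Forced B Ok u → Ok u v → Adjacent G u v →
            (∀ w → Adjacent G u w → w ≢ v → Forced B Ok w) → Forced B Ok v

  Pending : Subset n → Fin n → Fin n → Set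
  Pending S u v = Adjacent G u v × (∀ w → Adjacent G u w → w ≢ v → w ∈ S) × v ∉ S

  Pending? : ∀ S → Decidable (Pending S)
  Pending? S u v =
    Adjacent? u v ×-dec all? (λ w → Adjacent? u w →-dec (¬? (w ≟ v) →-dec (w ∈? S))) ×-dec ¬? (v ∈? S)

  pending-unique : ∀ {S u v w} → Pending S u v → Adjacent G u w → w ∉ S → w ≡ v
  pending-unique {v = v} {w = w} (_ , others , _) u~w w∉S with w ≟ v
  ... | yes w≡v = w≡v
  ... | no  w≢v = ⊥-elim (w∉S (others w u~w w≢v))

  Closed : Subset n → (Fin n → Fin n → Set) → Subset n → Set
  Closed B Ok S = B ⊆ S × (∀ {u v} → u ∈ S → Ok u v → ¬ Pending S u v)

  Forced⊆closed : ∀ {B Ok S v} → Closed B Ok S → Forced B Ok v → v ∈ S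
  Forced⊆closed (B⊆S , _)      (init v∈B) = B⊆S v∈B
  Forced⊆closed {S = S} {v = v} closed@(_ , stuck) (force blue-u ok u~v blue-others)
    with v ∈? S
  ... | yes v∈S = v∈S
  ... | no  v∉S = ⊥-elim (stuck (Forced⊆closed closed blue-u) ok
                                (u~v , (λ w u~w w≢v → Forced⊆closed closed (blue-others w u~w w≢v)) , v∉S))

  IsFinalColoring : Subset n → (Fin n → Fin n → Set) → Subset n → Set
  IsFinalColoring B Ok C = Closed B Ok C × (∀ {v} → v ∈ C → Forced B Ok v)

  module _ (B : Subset n) {Ok : Fin n → Fin n → Set} (Ok? : Decidable Ok) where

    private
      grow : ∀ S → Acc _⊃_ S → B ⊆ S → (∀ {v} → v ∈ S → Forced B Ok v) → ∃ (IsFinalColoring B Ok)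
      grow S (acc smaller) B⊆S S-forced
        with any? (λ u → any? (λ v → (u ∈? S) ×-dec Ok? u v ×-dec Pending? S u v))
      ... | no  stuck = S , (B⊆S , λ u∈S ok pending → stuck (_ , _ , u∈S , ok , pending)) , S-forced
      ... | yes (u , v , u∈S , ok , u~v , others , v∉S) =
        grow (⁅ v ⁆ ∪ S) (smaller (q⊆p∪q ⁅ v ⁆ S , v , x∈p∪q⁺ (inj₁ (x∈⁅x⁆ v)) , v∉S))
             (λ x∈B → q⊆p∪q ⁅ v ⁆ S (B⊆S x∈B)) forced′
        where
        forced′ : ∀ {x} → x ∈ ⁅ v ⁆ ∪ S → Forced B Ok x
        forced′ x∈ with x∈p∪q⁻ ⁅ v ⁆ S x∈
        ... | inj₂ x∈S = S-forced x∈S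
        ... | inj₁ x∈v with x∈⁅y⁆⇒x≡y v x∈v
        ... | refl = force (S-forced u∈S) ok u~v (λ w u~w w≢v → S-forced (others w u~w w≢v))

    finalColoring : ∃ (IsFinalColoring B Ok)
    finalColoring = grow B (⊃-wellFounded B) (λ v∈B → v∈B) init

VertexLeakRule : ∀ {n} → Subset n → Fin n → Fin n → Set
VertexLeakRule L u _ = u ∉ L

EdgeLeakRule : ∀ {n} → List (Fin n × Fin n) → Fin n → Fin n → Set
EdgeLeakRule E u v = ¬ ((u , v) List.∈ E ⊎ (v , u) List.∈ E)

VertexLeakRule? : ∀ {n} (L : Subset n) → Decidable (VertexLeakRule L)
VertexLeakRule? L u _ = ¬? (u ∈? L)

EdgeLeakRule? : ∀ {n} (E : List (Fin n × Fin n)) → Decidable (EdgeLeakRule E)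
EdgeLeakRule? E u v = ¬? (∈?-with ≟-pair (u , v) E ⊎-dec ∈?-with ≟-pair (v , u) E)
  where ≟-pair = ≡-dec _≟_ _≟_

module _ {n} {G : Graph n} {B : Subset n} where

  VBlue⇒Forced : ∀ {L v} → VBlue G B L v → Forced G B (VertexLeakRule L) v
  VBlue⇒Forced (init v∈B)                = init v∈B
  VBlue⇒Forced (force blue-u ok u~v rest) =
    force (VBlue⇒Forced blue-u) ok u~v (λ w u~w w≢v → VBlue⇒Forced (rest w u~w w≢v))

  Forced⇒VBlue : ∀ {L v} → Forced G B (VertexLeakRule L) v → VBlue G B L v
  Forced⇒VBlue (init v∈B)                = init v∈B
  Forced⇒VBlue (force blue-u ok u~v rest) =
    force (Forced⇒VBlue blue-u) ok u~v (λ w u~w w≢v → Forced⇒VBlue (rest w u~w w≢v))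

  EBlue⇒Forced : ∀ {E v} → EBlue G B E v → Forced G B (EdgeLeakRule E) v
  EBlue⇒Forced (init v∈B)                = init v∈B
  EBlue⇒Forced (force blue-u ok u~v rest) =
    force (EBlue⇒Forced blue-u) ok u~v (λ w u~w w≢v → EBlue⇒Forced (rest w u~w w≢v))

  Forced⇒EBlue : ∀ {E v} → Forced G B (EdgeLeakRule E) v → EBlue G B E v
  Forced⇒EBlue (init v∈B)                = init v∈B
  Forced⇒EBlue (force blue-u ok u~v rest) =
    force (Forced⇒EBlue blue-u) ok u~v (λ w u~w w≢v → Forced⇒EBlue (rest w u~w w≢v))

module EdgeLeaksAsVertexLeaks {n} (G : Graph n) (C : Subset n) where

  blockingEndpoint : Fin n × Fin n → Fin n
  blockingEndpoint (x , y) with y ∈? C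
  ... | yes _ = y
  ... | no  _ = x

  blockingEndpoint-∈ : ∀ x {y} → y ∈ C → blockingEndpoint (x , y) ≡ y
  blockingEndpoint-∈ x {y} y∈C with y ∈? C
  ... | yes _   = refl
  ... | no  y∉C = ⊥-elim (y∉C y∈C)

  blockingEndpoint-∉ : ∀ x {y} → y ∉ C → blockingEndpoint (x , y) ≡ x
  blockingEndpoint-∉ x {y} y∉C with y ∈? C
  ... | yes y∈C = ⊥-elim (y∉C y∈C)
  ... | no  _   = refl

  vertexLeaks : List (Fin n × Fin n) → Subset n
  vertexLeaks E = fromList (map blockingEndpoint E)

  ∣vertexLeaks∣≤length : ∀ E → ∣ vertexLeaks E ∣ ≤ length E
  ∣vertexLeaks∣≤length E =
    ≤-trans (∣fromList∣≤length (map blockingEndpoint E)) (≤-reflexive (length-map blockingEndpoint E))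

  closed-vertexLeaks : ∀ {B} E → Closed G B (EdgeLeakRule E) C →
                       Closed G B (VertexLeakRule (vertexLeaks E)) C
  closed-vertexLeaks E (B⊆C , stuck) = B⊆C , λ {u} {v} u∈C u∉L pending@(_ , _ , v∉C) →
    stuck u∈C (λ { (inj₁ uv∈E) → u∉L (leaked uv∈E (blockingEndpoint-∉ u v∉C))
                 ; (inj₂ vu∈E) → u∉L (leaked vu∈E (blockingEndpoint-∈ v u∈C)) })
          pending
    where
    leaked : ∀ {e x} → e List.∈ E → blockingEndpoint e ≡ x → x ∈ vertexLeaks E
    leaked e∈E refl = ∈-fromList (∈-map⁺ blockingEndpoint e∈E)

module VertexLeaksAsEdgeLeaks {n} (G : Graph n) (C : Subset n) where

  WhiteNeighbour : Fin n → Fin n → Set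
  WhiteNeighbour u v = Adjacent G u v × v ∉ C

  whiteNeighbour? : ∀ u → Dec (∃ (WhiteNeighbour u))
  whiteNeighbour? u = any? (λ v → Adjacent? G u v ×-dec ¬? (v ∈? C))

  edgeLeaks : List (Fin n) → List (Fin n × Fin n)
  edgeLeaks []       = []
  edgeLeaks (u ∷ us) with whiteNeighbour? u
  ... | yes (v , _) = (u , v) ∷ edgeLeaks us
  ... | no  _       = edgeLeaks us

  edgeLeaks-adjacent : ∀ us → All (λ e → Adjacent G (proj₁ e) (proj₂ e)) (edgeLeaks us)
  edgeLeaks-adjacent []       = []
  edgeLeaks-adjacent (u ∷ us) with whiteNeighbour? u
  ... | yes (_ , u~v , _) = u~v ∷ edgeLeaks-adjacent us
  ... | no  _             = edgeLeaks-adjacent us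

  length-edgeLeaks : ∀ us → length (edgeLeaks us) ≤ length us
  length-edgeLeaks []       = z≤n
  length-edgeLeaks (u ∷ us) with whiteNeighbour? u
  ... | yes _ = s≤s (length-edgeLeaks us)
  ... | no  _ = m≤n⇒m≤1+n (length-edgeLeaks us)

  pending∈edgeLeaks : ∀ {u v us} → u List.∈ us → Pending G C u v → (u , v) List.∈ edgeLeaks us
  pending∈edgeLeaks {u} {v} {x ∷ us} u∈us pending@(u~v , _ , v∉C) with whiteNeighbour? x | u∈us
  ... | yes (w , x~w , w∉C) | here refl
    rewrite pending-unique G pending x~w w∉C = here refl
  ... | yes _               | there u∈us′ = there (pending∈edgeLeaks u∈us′ pending)
  ... | no  none            | here refl   = ⊥-elim (none (v , u~v , v∉C))
  ... | no  _               | there u∈us′ = pending∈edgeLeaks u∈us′ pending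

  closed-edgeLeaks : ∀ {B} L → Closed G B (VertexLeakRule L) C →
                     Closed G B (EdgeLeakRule (edgeLeaks (elements L))) C
  closed-edgeLeaks L (B⊆C , stuck) = B⊆C , λ u∈C ok pending → stuck u∈C
    (λ u∈L → ok (inj₁ (pending∈edgeLeaks (∈-elements u∈L) pending))) pending

leaky⇒edgeLeaky : ∀ {n} (G : Graph n) ℓ B → LeakyForcing G ℓ B → EdgeLeakyForcing G ℓ B
leaky⇒edgeLeaky G ℓ B leaky E _ |E|≤ℓ v with finalColoring G B (EdgeLeakRule? E)
... | C , closed , C-forced =
  Forced⇒EBlue (C-forced (Forced⊆closed G (closed-vertexLeaks E closed)
                                        (VBlue⇒Forced (leaky L |L|≤ℓ v))))
  where
  open EdgeLeaksAsVertexLeaks G C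
  L = vertexLeaks E
  |L|≤ℓ = ≤-trans (∣vertexLeaks∣≤length E) |E|≤ℓ

edgeLeaky⇒leaky : ∀ {n} (G : Graph n) ℓ B → EdgeLeakyForcing G ℓ B → LeakyForcing G ℓ B
edgeLeaky⇒leaky G ℓ B edgeLeaky L |L|≤ℓ v with finalColoring G B (VertexLeakRule? L)
... | C , closed , C-forced =
  Forced⇒VBlue (C-forced (Forced⊆closed G (closed-edgeLeaks L closed)
                                        (EBlue⇒Forced (edgeLeaky E E-adjacent |E|≤ℓ v))))
  where
  open VertexLeaksAsEdgeLeaks G C
  E = edgeLeaks (elements L)
  E-adjacent = edgeLeaks-adjacent (elements L)
  |E|≤ℓ = ≤-trans (length-edgeLeaks (elements L)) (≤-trans (≤-reflexive (length-elements L)) |L|≤ℓ)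

IsMinimumSize : ∀ {n} → (Subset n → Set) → ℕ → Set
IsMinimumSize {n} P k = (Σ (Subset n) λ B → ∣ B ∣ ≡ k × P B) × (∀ B → P B → k ≤ ∣ B ∣)

IsMinimumSize-cong : ∀ {n} {P Q : Subset n → Set} → (∀ B → P B ⇔ Q B) →
                     ∀ k → IsMinimumSize P k ⇔ IsMinimumSize Q k
IsMinimumSize-cong P⇔Q k = mk⇔ (transport P⇔Q) (transport (λ B → ⇔-sym (P⇔Q B)))
  where
  transport : ∀ {P Q : Subset _ → Set} → (∀ B → P B ⇔ Q B) → IsMinimumSize P k → IsMinimumSize Q k
  transport P⇔Q ((B , |B|≡k , P-B) , minimal) =
    (B , |B|≡k , Equivalence.to (P⇔Q B) P-B) , λ B′ Q-B′ → minimal B′ (Equivalence.from (P⇔Q B′) Q-B′)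

corollary2p4 : ∀ {n} (G : Graph n) (ℓ : ℕ) →
    (∀ (k : ℕ) → IsLeakyForcingNumber G ℓ k ⇔ IsEdgeLeakyForcingNumber G ℓ k) ×
    (∀ (B : Subset n) → LeakyForcing G ℓ B ⇔ EdgeLeakyForcing G ℓ B)
corollary2p4 G ℓ = IsMinimumSize-cong leaky⇔edgeLeaky , leaky⇔edgeLeaky
  where
  leaky⇔edgeLeaky : ∀ B → LeakyForcing G ℓ B ⇔ EdgeLeakyForcing G ℓ B
  leaky⇔edgeLeaky B = mk⇔ (leaky⇒edgeLeaky G ℓ B) (edgeLeaky⇒leaky G ℓ B)
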